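{- For every integer $r$ with $1\leq r\leq d_1$: $p(r;2)=1$ if $r\leq (d_1+1)/2$, and $p(r;2)=0$ if $r>(d_1+1)/2$. More precisely, for $r\leq (d_1+1)/2$ the only word $w$ of length $r$ such that $w^2$ is a factor of $\mathbf{s}$ is $w=a_1^r$, and for $(d_1+1)/2<r\leq d_1$ there is no such word.
   Context: Fix $k\geq 2$ and the alphabet $\mathcal{A}_k=\{a_1,\dots,a_k\}$. An infinite word $\mathbf{t}$ is standard episturmian with directive word $x_1x_2x_3\cdots$ ($x_i$ letters) if its palindromic prefixes $u_1=\varepsilon,u_2,\dots$ satisfy $u_{n+1}=(u_nx_n)^{(+)}$, where $w^{(+)}$ is the shortest palindrome having $w$ as a prefix, and $\mathbf{t}=\lim_n u_n$. Let $(d_i)_{i\geq1}$ be positive integers and let $\mathbf{s}$ be the standard episturmian word with directive word $a_1^{d_1}a_2^{d_2}\cdots a_k^{d_k}a_1^{d_{k+1}}a_2^{d_{k+2}}\cdots a_k^{d_{2k}}a_1^{d_{2k+1}}\cdots$. For integers $m\geq1$, $l\geq 2$, $p(m;l)$ denotes the number of words $w$ with $|w|=m$ such that $w^l$ is a factor of $\mathbf{s}$. -}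

module Defs where

open import Data.Nat using (ℕ; zero; suc; _+_; _≤_; _<_; NonZero)
open import Data.Nat.DivMod using (_mod_)
open import Data.Fin using (Fin)
open import Data.List using (List; []; _∷_; _++_; reverse; map; upTo; length)
open import Data.Product using (∃; Σ; _×_)
open import Relation.Binary.PropositionalEquality using (_≡_)

-- Alphabet A_k = {a_1,…,a_k} is Fin k; the letter a_{i+1} is (i mod k),
-- so a_1 is (0 mod k).
letter : (k : ℕ) → .{{_ : NonZero k}} → ℕ → Fin k
letter k i = i mod k

a₁ : (k : ℕ) → .{{_ : NonZero k}} → Fin k
a₁ k = letter k 0

Palindrome : {A : Set} → List A → Set
Palindrome v = reverse v ≡ v

IsPrefix : {A : Set} → List A → List A → Set
IsPrefix w v = ∃ λ z → v ≡ w ++ z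

IsPalClosure : {A : Set} → List A → List A → Set
IsPalClosure w v =
  Palindrome v × IsPrefix w v ×
  (∀ v' → Palindrome v' → IsPrefix w v' → length v ≤ length v')

-- B j = d_1 + … + d_j  (d is indexed from 1; d 0 is unused).
blockEnd : (ℕ → ℕ) → ℕ → ℕ
blockEnd d zero = 0
blockEnd d (suc j) = blockEnd d j + d (suc j)

-- x (indexed from 1) is the directive word
-- a_1^{d_1} a_2^{d_2} … a_k^{d_k} a_1^{d_{k+1}} … :
-- the (j+1)-th block occupies positions B j < n ≤ B (j+1) and is made of
-- the letter a_{(j mod k)+1}.
IsDirective : (k : ℕ) → .{{_ : NonZero k}} → (ℕ → ℕ) → (ℕ → Fin k) → Set
IsDirective k d x =
  ∀ j n → blockEnd d j < n → n ≤ blockEnd d (suc j) → x n ≡ letter k j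

-- u (indexed from 1) are the palindromic prefixes: u_1 = ε,
-- u_{n+1} = (u_n x_n)^(+).
IsPalPrefixes : {A : Set} → (ℕ → A) → (ℕ → List A) → Set
IsPalPrefixes x u =
  (u 1 ≡ []) × (∀ n → 1 ≤ n → IsPalClosure (u n ++ (x n ∷ [])) (u (suc n)))

window : {A : Set} → (ℕ → A) → ℕ → ℕ → List A
window s i m = map (λ j → s (i + j)) (upTo m)

-- s = lim u_n : every u_n is a prefix of s.
IsLimit : {A : Set} → (ℕ → List A) → (ℕ → A) → Set
IsLimit u s = ∀ n → 1 ≤ n → window s 0 (length (u n)) ≡ u n

Factor : {A : Set} → List A → (ℕ → A) → Set
Factor w s = ∃ λ i → window s i (length w) ≡ w

-- All palindromic prefixes u_n (n > D) are prefixes of s with s = a^D b …, b ≠ a, and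
-- satisfy two invariants: (Sparse) two letters ≠ a are more than D apart, and (RunFree) there is
-- no run a^(D+2).  They pass from u_n to u_{n+1} = (u_n x_n)^(+) = u_n x_n z because u_{n+1}
-- ends with a copy of u_n (so it has period 1 + |z|), |z| ≤ |u_n|, and |z| ≤ |u_n| - D when
-- x_n = a (minimality of the closure, compared with the palindrome u_n x_n m where
-- u_n = a^(D-1) a m); so only windows around the junction letter x_n need inspection.  The
-- prefix closed by the first letter a of block k + 1 moreover ends with a^(D+1).  Finally, in
-- any word with these three properties a square w^2 with |w| ≤ D forces w = a^r (by
-- Sparse), occurs iff a^(2r) fits in a^(D+1) (by RunFree and the long run).

module Submission where

open import Defs
open import Data.Nat using (ℕ; _+_; _*_; _≤_; _<_; NonZero)
open import Data.Fin using (Fin)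
open import Data.List using (List; _++_; length; replicate)
open import Data.Product using (_×_)
open import Relation.Binary.PropositionalEquality using (_≡_)
open import Relation.Nullary using (¬_)
open import Function.Bundles using (_⇔_)

open import Data.Nat using (zero; suc; _∸_; z≤n; s≤s; s≤s⁻¹; z<s; s<s; _≤?_; _<?_)
open import Data.Nat.Properties
open import Data.List using ([]; _∷_; reverse; applyUpTo; applyDownFrom)
open import Data.List.Properties
  using (length-++; reverse-++; ++-assoc; ++-identityʳ; ∷-injectiveˡ; ∷-injectiveʳ;
         length-replicate; length-applyUpTo; map-upTo; reverse-applyUpTo)
open import Data.Product using (∃; _,_; proj₁; proj₂)
open import Data.Sum using (_⊎_; inj₁; inj₂)
import Data.Sum as Sum
open import Data.Fin using (toℕ)
open import Data.Fin.Properties using (toℕ-injective; toℕ-fromℕ<)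
open import Data.Nat.DivMod using (_%_; n%n≡0; m%n<n)
open import Relation.Binary.PropositionalEquality using (refl; sym; trans; cong; cong₂; subst; subst₂; _≢_; module ≡-Reasoning)
open import Relation.Nullary using (Dec; yes; no)
open import Data.Empty using (⊥; ⊥-elim)
open import Function using (_∘_)
open import Function.Bundles using (mk⇔)
open import Data.Nat.Tactic.RingSolver using (solve-∀)

module _ {A : Set} where

  applyUpTo-++ : ∀ (f : ℕ → A) m n →
    applyUpTo f (m + n) ≡ applyUpTo f m ++ applyUpTo (λ t → f (m + t)) n
  applyUpTo-++ f zero n = refl
  applyUpTo-++ f (suc m) n = cong (f 0 ∷_) (applyUpTo-++ (f ∘ suc) m n)

  applyUpTo-cong : ∀ {f g : ℕ → A} n → (∀ t → t < n → f t ≡ g t) → applyUpTo f n ≡ applyUpTo g n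
  applyUpTo-cong zero _ = refl
  applyUpTo-cong (suc n) f≗g = cong₂ _∷_ (f≗g 0 z<s) (applyUpTo-cong n (λ t t<n → f≗g (suc t) (s<s t<n)))

  applyUpTo-injective : ∀ {f g : ℕ → A} n → applyUpTo f n ≡ applyUpTo g n → ∀ t → t < n → f t ≡ g t
  applyUpTo-injective (suc n) eq zero _ = ∷-injectiveˡ eq
  applyUpTo-injective (suc n) eq (suc t) (s<s t<n) = applyUpTo-injective n (∷-injectiveʳ eq) t t<n

  replicate-applyUpTo : ∀ n (c : A) → replicate n c ≡ applyUpTo (λ _ → c) n
  replicate-applyUpTo zero c = refl
  replicate-applyUpTo (suc n) c = cong (c ∷_) (replicate-applyUpTo n c)

  replicate-++ : ∀ m n (c : A) → replicate m c ++ replicate n c ≡ replicate (m + n) c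
  replicate-++ m n c = begin
    replicate m c ++ replicate n c                     ≡⟨ cong₂ _++_ (replicate-applyUpTo m c) (replicate-applyUpTo n c) ⟩
    applyUpTo (λ _ → c) m ++ applyUpTo (λ _ → c) n     ≡⟨ sym (applyUpTo-++ (λ _ → c) m n) ⟩
    applyUpTo (λ _ → c) (m + n)                        ≡⟨ sym (replicate-applyUpTo (m + n) c) ⟩
    replicate (m + n) c                                ∎
    where open ≡-Reasoning

  replicate-++-∷ : ∀ n (c : A) m → replicate n c ++ c ∷ m ≡ c ∷ replicate n c ++ m
  replicate-++-∷ zero c m = refl
  replicate-++-∷ (suc n) c m = cong (c ∷_) (replicate-++-∷ n c m)

  applyDownFrom-applyUpTo : ∀ (f : ℕ → A) n → applyDownFrom f n ≡ applyUpTo (λ t → f (n ∸ suc t)) n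
  applyDownFrom-applyUpTo f zero = refl
  applyDownFrom-applyUpTo f (suc n) = cong (f n ∷_) (applyDownFrom-applyUpTo f n)

  palindrome-mirror : ∀ (f : ℕ → A) n → Palindrome (applyUpTo f n) →
    ∀ i j → suc (i + j) ≡ n → f i ≡ f j
  palindrome-mirror f .(suc (i + j)) pal i j refl = begin
    f i                   ≡⟨ sym (applyUpTo-injective {f = λ t → f (suc (i + j) ∸ suc t)} {g = f}
                                (suc (i + j)) reversed i (s≤s (m≤m+n i j))) ⟩
    f (i + j ∸ i)         ≡⟨ cong f (m+n∸m≡n i j) ⟩
    f j                   ∎
    where
      open ≡-Reasoning
      reversed : applyUpTo (λ t → f (suc (i + j) ∸ suc t)) (suc (i + j)) ≡ applyUpTo f (suc (i + j))
      reversed = trans (sym (trans (reverse-applyUpTo f _) (applyDownFrom-applyUpTo f _))) pal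

  palindrome-replicate : ∀ n (c : A) → Palindrome (replicate n c)
  palindrome-replicate n c = begin
    reverse (replicate n c)          ≡⟨ cong reverse (replicate-applyUpTo n c) ⟩
    reverse (applyUpTo (λ _ → c) n)  ≡⟨ reverse-applyUpTo (λ _ → c) n ⟩
    applyDownFrom (λ _ → c) n        ≡⟨ applyDownFrom-applyUpTo (λ _ → c) n ⟩
    applyUpTo (λ _ → c) n            ≡⟨ sym (replicate-applyUpTo n c) ⟩
    replicate n c                    ∎
    where open ≡-Reasoning

  palindrome-double : ∀ {u : List A} y → Palindrome u → Palindrome (u ++ y ∷ u)
  palindrome-double {u} y pal = begin
    reverse (u ++ y ∷ u)          ≡⟨ reverse-++ u (y ∷ u) ⟩
    reverse (y ∷ u) ++ reverse u  ≡⟨ cong₂ _++_ (reverse-++ (y ∷ []) u) pal ⟩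
    (reverse u ++ y ∷ []) ++ u    ≡⟨ cong (λ v → (v ++ y ∷ []) ++ u) pal ⟩
    (u ++ y ∷ []) ++ u            ≡⟨ ++-assoc u (y ∷ []) u ⟩
    u ++ y ∷ u                    ∎
    where open ≡-Reasoning

  palindrome-extend : ∀ {t m : List A} → Palindrome (t ++ m) → Palindrome t → Palindrome ((t ++ m) ++ m)
  palindrome-extend {t} {m} palu palt = begin
    reverse ((t ++ m) ++ m)          ≡⟨ reverse-++ (t ++ m) m ⟩
    reverse m ++ reverse (t ++ m)    ≡⟨ cong (reverse m ++_) palu ⟩
    reverse m ++ (t ++ m)            ≡⟨ sym (++-assoc (reverse m) t m) ⟩
    (reverse m ++ t) ++ m            ≡⟨ cong (λ v → (reverse m ++ v) ++ m) (sym palt) ⟩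
    (reverse m ++ reverse t) ++ m    ≡⟨ cong (_++ m) (sym (reverse-++ t m)) ⟩
    reverse (t ++ m) ++ m            ≡⟨ cong (_++ m) palu ⟩
    (t ++ m) ++ m                    ∎
    where open ≡-Reasoning

  closure-extends : ∀ {u v : List A} {y} → IsPalClosure (u ++ y ∷ []) v → ∃ λ z → v ≡ u ++ y ∷ z
  closure-extends {u} {y = y} (_ , (z , v≡) , _) = z , trans v≡ (++-assoc u (y ∷ []) z)

  closure-of-palindrome : ∀ {w v : List A} → IsPalClosure w v → Palindrome w → v ≡ w
  closure-of-palindrome {w} (_ , ([] , v≡w++[]) , _) _ = trans v≡w++[] (++-identityʳ w)
  closure-of-palindrome {w} (_ , (c ∷ z , refl) , shortest) palw =
    ⊥-elim (m+1+n≰m (length w) (subst (_≤ length w) (length-++ w) (shortest w palw ([] , sym (++-identityʳ w)))))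

  closure-shortest : ∀ {u v z : List A} {y} (m : List A) → IsPalClosure (u ++ y ∷ []) v →
    v ≡ u ++ y ∷ z → Palindrome (u ++ y ∷ m) → length z ≤ length m
  closure-shortest {u} {z = z} {y} m (_ , _ , shortest) refl pal =
    m<1+n⇒m≤n (+-cancelˡ-≤ (length u) _ _
      (subst₂ _≤_ (length-++ u) (length-++ u)
        (shortest (u ++ y ∷ m) pal (m , sym (++-assoc u (y ∷ []) m)))))

  ++-cancel-equal-length : ∀ (xs ys : List A) {zs ws} → length xs ≡ length ys →
    xs ++ zs ≡ ys ++ ws → xs ≡ ys × zs ≡ ws
  ++-cancel-equal-length [] [] _ eq = refl , eq
  ++-cancel-equal-length (x ∷ xs) (y ∷ ys) len eq
    with ++-cancel-equal-length xs ys (suc-injective len) (∷-injectiveʳ eq)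
  ... | xs≡ys , zs≡ws = cong₂ _∷_ (∷-injectiveˡ eq) xs≡ys , zs≡ws

-- Arithmetic identity behind the period of a palindromic extension (see `shift`).
shift-arithmetic : ∀ g i j → suc (suc g + i + j) ≡ suc i + j + suc g
shift-arithmetic = solve-∀

module InfiniteWord {A : Set} (s : ℕ → A) (a : A) (D : ℕ) where

  Run : ℕ → ℕ → Set
  Run q m = ∀ t → t < m → s (q + t) ≡ a

  run-at : ∀ {q m n} → Run q m → q ≤ n → n < q + m → s n ≡ a
  run-at {q} {m} run q≤n n<q+m with m≤n⇒∃[o]m+o≡n q≤n
  ... | t , refl = run t (+-cancelˡ-< q t m n<q+m)

  run-snoc : ∀ {q m} → Run q m → s (q + m) ≡ a → Run q (suc m)
  run-snoc {q} {m} run last t t<1+m with m<1+n⇒m<n∨m≡n t<1+m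
  ... | inj₁ t<m = run t t<m
  ... | inj₂ refl = last

  window-run : ∀ q m → Run q m → window s q m ≡ replicate m a
  window-run q m run = trans (map-upTo _ m) (trans (applyUpTo-cong m run) (sym (replicate-applyUpTo m a)))

  run-window : ∀ q m → window s q m ≡ replicate m a → Run q m
  run-window q m eq = applyUpTo-injective m (trans (sym (map-upTo _ m)) (trans eq (replicate-applyUpTo m a)))

  Prefix : List A → Set
  Prefix v = applyUpTo s (length v) ≡ v

  prefix-letter : ∀ u {y z} → Prefix (u ++ y ∷ z) → s (length u) ≡ y
  prefix-letter = go s
    where
      go : (f : ℕ → A) (u : List A) {y : A} {z : List A} →
           applyUpTo f (length (u ++ y ∷ z)) ≡ u ++ y ∷ z → f (length u) ≡ y
      go f [] eq = ∷-injectiveˡ eq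
      go f (c ∷ u) eq = go (f ∘ suc) u (∷-injectiveʳ eq)

  prefix-run : ∀ n → Prefix (replicate n a) → Run 0 n
  prefix-run n pre = applyUpTo-injective n
    (trans (subst (λ m → applyUpTo s m ≡ replicate n a) (length-replicate n) pre) (replicate-applyUpTo n a))

  prefix-after-run : ∀ {v} n → Prefix v → Run 0 (suc n) → suc n ≤ length v →
    ∃ λ m → v ≡ replicate n a ++ a ∷ m
  prefix-after-run {v} n pre run n<|v| with m≤n⇒∃[o]m+o≡n n<|v|
  ... | R , len = applyUpTo (λ t → s (n + suc t)) R , (begin
    v                                                   ≡⟨ sym pre ⟩
    applyUpTo s (length v)                              ≡⟨ cong (applyUpTo s) (trans (sym len) (sym (+-suc n R))) ⟩
    applyUpTo s (n + suc R)                             ≡⟨ applyUpTo-++ s n (suc R) ⟩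
    applyUpTo s n ++ s (n + 0) ∷ applyUpTo (λ t → s (n + suc t)) R
        ≡⟨ cong₂ (λ w c → w ++ c ∷ applyUpTo (λ t → s (n + suc t)) R)
                 (trans (applyUpTo-cong n (λ t t<n → run t (m<n⇒m<1+n t<n))) (sym (replicate-applyUpTo n a)))
                 (subst (λ m → s m ≡ a) (sym (+-identityʳ n)) (run n (n<1+n n))) ⟩
    replicate n a ++ a ∷ applyUpTo (λ t → s (n + suc t)) R ∎)
    where open ≡-Reasoning

  Mirror : ℕ → Set
  Mirror L = ∀ i j → suc (i + j) ≡ L → s i ≡ s j

  Sparse : ℕ → Set
  Sparse L = ∀ i e → e < D → i + suc e < L → s i ≡ a ⊎ s (i + suc e) ≡ a

  RunFree : ℕ → Set
  RunFree L = ∀ q → q + suc D < L → ¬ Run q (suc (suc D))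

  -- How the palindromic prefix of length L' = L + 1 + gap arises from that of length L
  -- by palindromic closure: the gap is at most L, and at most L - D if the added letter is a.
  record Extension (L L' : ℕ) : Set where
    field
      gap      : ℕ
      total    : L' ≡ L + suc gap
      gap≤L    : gap ≤ L
      junction : s L ≡ a → gap + D ≤ L

  extension-grows : ∀ {L L'} → Extension L L' → L < L'
  extension-grows ext = subst (_ <_) (sym (Extension.total ext)) (m<m+n _ z<s)

  module Invariant (head : Run 0 D) (break : s D ≢ a) where

    Good : ℕ → Set
    Good L = Sparse L × RunFree L

    good-initial : Good D
    good-initial = sparse , runFree
      where
        sparse : Sparse D
        sparse i e _ i+1+e<D = inj₁ (head i (<-trans (m<m+n i z<s) i+1+e<D))
        runFree : RunFree D
        runFree q q+1+D<D _ = <-irrefl refl (<-trans q+1+D<D (m≤n+m (suc D) q))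

    closing-run : ∀ {L} → Mirror L → D ≤ L → s L ≡ a → Run (L ∸ D) (suc D)
    closing-run {L} mirror D≤L end = run-snoc mirrored-head (subst (λ n → s n ≡ a) (sym (m∸n+n≡m D≤L)) end)
      where
        mirrored-head : Run (L ∸ D) D
        mirrored-head t t<D with m≤n⇒∃[o]m+o≡n t<D
        ... | j , t+1+j≡D = trans (mirror (L ∸ D + t) j centred) (head j (subst (j <_) t+1+j≡D (m<n+m j z<s)))
          where
            centred : suc (L ∸ D + t + j) ≡ L
            centred = begin
              suc (L ∸ D + t + j)   ≡⟨ cong suc (+-assoc (L ∸ D) t j) ⟩
              suc (L ∸ D + (t + j)) ≡⟨ sym (+-suc (L ∸ D) (t + j)) ⟩
              L ∸ D + suc (t + j)   ≡⟨ cong (L ∸ D +_) t+1+j≡D ⟩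
              L ∸ D + D             ≡⟨ m∸n+n≡m D≤L ⟩
              L                     ∎
              where open ≡-Reasoning

    module Step {L g : ℕ} (mirror : Mirror L) (mirror' : Mirror (L + suc g)) (D≤L : D ≤ L)
                (g≤L : g ≤ L) (junction : s L ≡ a → g + D ≤ L) where

      -- The new prefix has period 1 + g: it ends with a copy of the old one.
      shift : ∀ i → i < L → s (suc g + i) ≡ s i
      shift i i<L with m≤n⇒∃[o]m+o≡n i<L
      ... | j , i+1+j≡L =
        trans (mirror' (suc g + i) j (trans (shift-arithmetic g i j) (cong (_+ suc g) i+1+j≡L)))
              (mirror j i (trans (cong suc (+-comm j i)) i+1+j≡L))

      sparse-copied : Sparse L → ∀ i e → e < D → suc g + i + suc e < L + suc g →
        s (suc g + i) ≡ a ⊎ s (suc g + i + suc e) ≡ a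
      sparse-copied sparse i e e<D far =
        Sum.map (trans (shift i (≤-<-trans (m≤m+n i (suc e)) inside)))
                (trans (cong s (+-assoc (suc g) i (suc e))) ∘ trans (shift (i + suc e) inside))
                (sparse i e e<D inside)
        where
          inside : i + suc e < L
          inside = +-cancelˡ-< (suc g) _ _ (subst₂ _<_ (+-assoc (suc g) i (suc e)) (+-comm L (suc g)) far)

      -- The second position lies in the copied head a^D.
      sparse-into-copy : ∀ i e → e < D → i < suc g → suc g ≤ i + suc e → s (i + suc e) ≡ a
      sparse-into-copy i e e<D i<1+g 1+g≤j with m≤n⇒∃[o]m+o≡n 1+g≤j
      ... | j' , 1+g+j'≡j = begin
        s (i + suc e)   ≡⟨ cong s (sym 1+g+j'≡j) ⟩
        s (suc g + j')  ≡⟨ shift j' (<-≤-trans j'<D D≤L) ⟩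
        s j'            ≡⟨ head j' j'<D ⟩
        a               ∎
        where
          open ≡-Reasoning
          j'<D : j' < D
          j'<D = <-≤-trans (+-cancelˡ-< (suc g) j' (suc e)
                   (subst (_< suc g + suc e) (sym 1+g+j'≡j) (+-monoˡ-< (suc e) i<1+g))) e<D

      -- Both positions lie before the copy, the second one at the end of the old prefix:
      -- by symmetry the first one lies in the head a^D.
      sparse-before-copy : ∀ i e → e < D → i + suc e < suc g → L ≤ i + suc e → s i ≡ a
      sparse-before-copy i e e<D j<1+g L≤j = trans (mirror i e centred) (head e e<D)
        where
          centred : suc (i + e) ≡ L
          centred = trans (sym (+-suc i e)) (≤-antisym (≤-trans (m<1+n⇒m≤n j<1+g) g≤L) L≤j)

      sparse-step : Sparse L → Sparse (L + suc g)
      sparse-step sparse i e e<D far with i + suc e <? L | suc g ≤? i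
      ... | yes inside | _ = sparse i e e<D inside
      ... | no outside | yes 1+g≤i with m≤n⇒∃[o]m+o≡n 1+g≤i
      ...   | i' , refl = sparse-copied sparse i' e e<D far
      sparse-step sparse i e e<D far | no outside | no i≱1+g with suc g ≤? i + suc e
      ...   | yes 1+g≤j = inj₂ (sparse-into-copy i e e<D (≰⇒> i≱1+g) 1+g≤j)
      ...   | no j≱1+g  = inj₁ (sparse-before-copy i e e<D (≰⇒> j≱1+g) (≮⇒≥ outside))

      runFree-copied : RunFree L → ∀ q → suc g + q + suc D < L + suc g → ¬ Run (suc g + q) (suc (suc D))
      runFree-copied runFree q far run = runFree q inside copied
        where
          inside : q + suc D < L
          inside = +-cancelˡ-< (suc g) _ _ (subst₂ _<_ (+-assoc (suc g) q (suc D)) (+-comm L (suc g)) far)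
          copied : Run q (suc (suc D))
          copied t t<2+D = begin
            s (q + t)          ≡⟨ sym (shift (q + t) (≤-<-trans (+-monoʳ-≤ q (m<1+n⇒m≤n t<2+D)) inside)) ⟩
            s (suc g + (q + t)) ≡⟨ cong s (sym (+-assoc (suc g) q t)) ⟩
            s (suc g + q + t)  ≡⟨ run t t<2+D ⟩
            a                  ∎
            where open ≡-Reasoning

      -- A run starting before the copy covers the junction letter at position L, which is
      -- therefore a; the run is then framed by the letter s D ≠ a at position L - 1 - D or
      -- at position 1 + g + D.
      runFree-junction : ∀ q → q < suc g → L ≤ q + suc D → ¬ Run q (suc (suc D))
      runFree-junction q q<1+g L≤q+1+D run = framed (suc g ≤? suc q)
        where
          end : s L ≡ a
          end = run-at run (m<1+n⇒m≤n (<-≤-trans q<1+g (s≤s g≤L)))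
                           (≤-<-trans L≤q+1+D (+-monoʳ-< q (n<1+n (suc D))))
          D<L : D < L
          D<L = ≤∧≢⇒< D≤L (λ D≡L → break (subst (λ n → s n ≡ a) (sym D≡L) end))
          framed : Dec (suc g ≤ suc q) → ⊥
          framed (yes 1+g≤1+q) =
            break (trans (sym (shift D D<L)) (run-at run (≤-trans (<⇒≤ q<1+g) (m≤m+n (suc g) D)) right-frame))
            where
              right-frame : suc g + D < q + suc (suc D)
              right-frame = begin-strict
                suc g + D              ≤⟨ +-monoˡ-≤ D 1+g≤1+q ⟩
                suc q + D              <⟨ n<1+n (suc (q + D)) ⟩
                suc (suc (q + D))      ≡⟨ sym (trans (+-suc q (suc D)) (cong suc (+-suc q D))) ⟩
                q + suc (suc D)        ∎
                where open ≤-Reasoning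
          framed (no 1+g≰1+q) = break (trans (sym (mirror q D centred)) (run-at run ≤-refl (m<m+n q z<s)))
            where
              centred : suc (q + D) ≡ L
              centred = ≤-antisym (≤-trans (+-monoˡ-≤ D (s≤s⁻¹ (≰⇒> 1+g≰1+q))) (junction end))
                                  (subst (L ≤_) (+-suc q D) L≤q+1+D)

      runFree-step : RunFree L → RunFree (L + suc g)
      runFree-step runFree q far run with q + suc D <? L | suc g ≤? q
      ... | yes inside | _ = runFree q inside run
      ... | no outside | yes 1+g≤q with m≤n⇒∃[o]m+o≡n 1+g≤q
      ...   | q' , refl = runFree-copied runFree q' far run
      runFree-step runFree q far run | no outside | no q≱1+g = runFree-junction q (≰⇒> q≱1+g) (≮⇒≥ outside) run

    good-step : ∀ {L L'} → Mirror L → Mirror L' → D ≤ L → Extension L L' → Good L → Good L'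
    good-step mirror mirror' D≤L record { gap = g ; total = refl ; gap≤L = g≤L ; junction = junction }
              (sparse , runFree) = sparse-step sparse , runFree-step runFree
      where open Step mirror mirror' D≤L g≤L junction

  module Squares (sparse : ∀ i e → e < D → s i ≡ a ⊎ s (i + suc e) ≡ a)
                 (runFree : ∀ q → ¬ Run q (suc (suc D)))
                 (longRun : ∃ λ q → Run q (suc D)) where

    window-++ : ∀ q m n → window s q (m + n) ≡ window s q m ++ window s (q + m) n
    window-++ q m n = begin
      window s q (m + n)                                                ≡⟨ map-upTo _ (m + n) ⟩
      applyUpTo (λ t → s (q + t)) (m + n)                               ≡⟨ applyUpTo-++ _ m n ⟩
      applyUpTo (λ t → s (q + t)) m ++ applyUpTo (λ t → s (q + (m + t))) n
        ≡⟨ cong₂ _++_ (sym (map-upTo _ m))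
                       (trans (applyUpTo-cong n (λ t _ → cong s (sym (+-assoc q m t)))) (sym (map-upTo _ n))) ⟩
      window s q m ++ window s (q + m) n                                ∎
      where open ≡-Reasoning

    window-length : ∀ q m → length (window s q m) ≡ m
    window-length q m = trans (cong length (map-upTo _ m)) (length-applyUpTo _ m)

    periodic-run : ∀ q r → r ≤ D → (∀ t → t < r → s (q + t) ≡ s (q + r + t)) → Run q r
    periodic-run q (suc e) 1+e≤D periodic t t<r with sparse (q + t) e 1+e≤D
    ... | inj₁ here = here
    ... | inj₂ there = trans (periodic t t<r) (trans (cong s shifted) there)
      where
        shifted : q + suc e + t ≡ q + t + suc e
        shifted = trans (+-assoc q (suc e) t) (trans (cong (q +_) (+-comm (suc e) t)) (sym (+-assoc q t (suc e))))

    square-is-power : ∀ r → r ≤ D → ∀ w → length w ≡ r → Factor (w ++ w) s → w ≡ replicate r a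
    square-is-power .(length w) r≤D w refl (q , ww) = begin
      w                     ≡⟨ sym first-half ⟩
      window s q (length w) ≡⟨ window-run q (length w) (periodic-run q (length w) r≤D periodic) ⟩
      replicate (length w) a ∎
      where
        open ≡-Reasoning
        halves : window s q (length w) ≡ w × window s (q + length w) (length w) ≡ w
        halves = ++-cancel-equal-length _ w (window-length q (length w))
                   (trans (sym (window-++ q (length w) (length w))) (trans (cong (window s q) (sym (length-++ w))) ww))
        first-half : window s q (length w) ≡ w
        first-half = proj₁ halves
        periodic : ∀ t → t < length w → s (q + t) ≡ s (q + length w + t)
        periodic = applyUpTo-injective (length w)
          (trans (sym (map-upTo _ (length w)))
            (trans (trans (proj₁ halves) (sym (proj₂ halves))) (map-upTo _ (length w))))

    length-power-square : ∀ r → length (replicate r a ++ replicate r a) ≡ r + r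
    length-power-square r = trans (length-++ (replicate r a)) (cong₂ _+_ (length-replicate r) (length-replicate r))

    short-square : ∀ r → r + r ≤ suc D → Factor (replicate r a ++ replicate r a) s
    short-square r 2r≤1+D = q , (begin
      window s q (length (replicate r a ++ replicate r a))  ≡⟨ cong (window s q) (length-power-square r) ⟩
      window s q (r + r)                                    ≡⟨ window-run q (r + r) (λ t t<2r → run t (<-≤-trans t<2r 2r≤1+D)) ⟩
      replicate (r + r) a                                   ≡⟨ sym (replicate-++ r r a) ⟩
      replicate r a ++ replicate r a                        ∎)
      where
        open ≡-Reasoning
        q : ℕ
        q = proj₁ longRun
        run : Run q (suc D)
        run = proj₂ longRun

    -- A square of length 2r > D + 1 would be a^r a^r, a run longer than allowed.
    no-long-square : ∀ r → r ≤ D → suc D < r + r → ∀ w → length w ≡ r → ¬ Factor (w ++ w) s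
    no-long-square r r≤D 1+D<2r w |w|≡r factor@(q , ww) with square-is-power r r≤D w |w|≡r factor
    ... | refl = runFree q (λ t t<2+D → long-run t (<-≤-trans t<2+D 1+D<2r))
      where
        long-run : Run q (r + r)
        long-run = run-window q (r + r) (begin
          window s q (r + r)                                    ≡⟨ cong (window s q) (sym (length-power-square r)) ⟩
          window s q (length (replicate r a ++ replicate r a))  ≡⟨ ww ⟩
          replicate r a ++ replicate r a                        ≡⟨ replicate-++ r r a ⟩
          replicate (r + r) a                                   ∎)
          where open ≡-Reasoning

letter-period : (k : ℕ) .{{_ : NonZero k}} → letter k k ≡ a₁ k
letter-period (suc k) = toℕ-injective (begin
  toℕ (letter (suc k) (suc k)) ≡⟨ toℕ-fromℕ< _ ⟩
  suc k % suc k                ≡⟨ n%n≡0 (suc k) ⟩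
  0                            ≡⟨ sym (toℕ-fromℕ< (m%n<n 0 (suc k))) ⟩
  toℕ (a₁ (suc k))             ∎)
  where open ≡-Reasoning

second-letter≢first : (k : ℕ) .{{_ : NonZero k}} → 2 ≤ k → letter k 1 ≢ a₁ k
second-letter≢first (suc zero) (s≤s ())
second-letter≢first (suc (suc k)) _ ()

first-block≤ : (d : ℕ → ℕ) → ∀ j → 1 ≤ j → d 1 ≤ blockEnd d j
first-block≤ d (suc zero) _ = ≤-refl
first-block≤ d (suc (suc j)) _ = ≤-trans (first-block≤ d (suc j) (s≤s z≤n)) (m≤m+n _ _)

module StandardEpisturmian (k : ℕ) .{{_ : NonZero k}} (k≥2 : 2 ≤ k)
    (d : ℕ → ℕ) (d≥1 : ∀ i → 1 ≤ i → 1 ≤ d i)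
    (x : ℕ → Fin k) (directive : IsDirective k d x)
    (u : ℕ → List (Fin k)) (palPrefixes : IsPalPrefixes x u)
    (s : ℕ → Fin k) (limit : IsLimit u s) where

  a : Fin k
  a = a₁ k

  D : ℕ
  D = d 1

  open InfiniteWord s a D

  L : ℕ → ℕ
  L n = length (u n)

  first-block : ∀ n → 1 ≤ n → n ≤ D → x n ≡ a
  first-block = directive 0

  block-start : ∀ j → x (suc (blockEnd d j)) ≡ letter k j
  block-start j = directive j _ (n<1+n _)
    (subst (_≤ blockEnd d j + d (suc j)) (+-comm (blockEnd d j) 1) (+-monoʳ-≤ (blockEnd d j) (d≥1 (suc j) (s≤s z≤n))))

  prefix : ∀ n → 1 ≤ n → Prefix (u n)
  prefix n 1≤n = trans (sym (map-upTo s (L n))) (limit n 1≤n)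

  palindromic : ∀ n → 1 ≤ n → Palindrome (u n)
  palindromic (suc zero) _ = subst Palindrome (sym (proj₁ palPrefixes)) refl
  palindromic (suc (suc n)) _ = proj₁ (proj₂ palPrefixes (suc n) (s≤s z≤n))

  closure : ∀ n → 1 ≤ n → IsPalClosure (u n ++ x n ∷ []) (u (suc n))
  closure = proj₂ palPrefixes

  mirror : ∀ n → 1 ≤ n → Mirror (L n)
  mirror n 1≤n = palindrome-mirror s (L n) (subst Palindrome (sym (prefix n 1≤n)) (palindromic n 1≤n))

  letter-after : ∀ n → 1 ≤ n → s (L n) ≡ x n
  letter-after n 1≤n with closure-extends (closure n 1≤n)
  ... | z , extended = prefix-letter (u n) (subst Prefix extended (prefix (suc n) (s≤s z≤n)))

  -- While the directive letter is a, closure just appends it: u_{m+1} = a^m for m ≤ D.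
  initial : ∀ m → m ≤ D → u (suc m) ≡ replicate m a
  initial zero _ = proj₁ palPrefixes
  initial (suc m) 1+m≤D = begin
    u (suc (suc m))          ≡⟨ closure-of-palindrome closure' (subst Palindrome (sym power) (palindrome-replicate (suc m) a)) ⟩
    replicate m a ++ a ∷ []  ≡⟨ power ⟩
    replicate (suc m) a      ∎
    where
      open ≡-Reasoning
      closure' : IsPalClosure (replicate m a ++ a ∷ []) (u (suc (suc m)))
      closure' = subst₂ (λ v y → IsPalClosure (v ++ y ∷ []) (u (suc (suc m))))
                   (initial m (<⇒≤ 1+m≤D)) (first-block (suc m) (s≤s z≤n) 1+m≤D) (closure (suc m) (s≤s z≤n))
      power : replicate m a ++ a ∷ [] ≡ replicate (suc m) a
      power = trans (replicate-++-∷ m a []) (cong (a ∷_) (++-identityʳ (replicate m a)))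

  L-initial : L (suc D) ≡ D
  L-initial = trans (cong length (initial D ≤-refl)) (length-replicate D)

  head : Run 0 D
  head = prefix-run D (subst Prefix (initial D ≤-refl) (prefix (suc D) (s≤s z≤n)))

  break : s D ≢ a
  break end = second-letter≢first k k≥2 (begin
    letter k 1      ≡⟨ sym (block-start 1) ⟩
    x (suc D)       ≡⟨ sym (letter-after (suc D) (s≤s z≤n)) ⟩
    s (L (suc D))   ≡⟨ cong s L-initial ⟩
    s D             ≡⟨ end ⟩
    a               ∎)
    where open ≡-Reasoning

  D-positive : ∃ λ D' → suc D' ≡ D
  D-positive = m≤n⇒∃[o]m+o≡n (d≥1 1 (s≤s z≤n))

  -- If x_n = a, then u_n = a^(D-1) a m and u_n a m is a palindrome extending u_n a, so the
  -- closure u_{n+1} = u_n a z has |z| ≤ |m| = |u_n| - D.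
  junction-bound : ∀ n → 1 ≤ n → D ≤ L n → ∀ {z} → u (suc n) ≡ u n ++ x n ∷ z → x n ≡ a → length z + D ≤ L n
  junction-bound n 1≤n D≤L {z} extended xₙ≡a with D-positive
  ... | D' , 1+D'≡D with prefix-after-run D' (prefix n 1≤n) (subst (Run 0) (sym 1+D'≡D) head) (subst (_≤ L n) (sym 1+D'≡D) D≤L)
  ...   | m , shape = begin
    length z + D             ≤⟨ +-monoˡ-≤ D (closure-shortest m (closure n 1≤n) extended candidate) ⟩
    length m + D             ≡⟨ cong (length m +_) (sym 1+D'≡D) ⟩
    length m + suc D'        ≡⟨ trans (+-suc (length m) D') (cong suc (+-comm (length m) D')) ⟩
    suc (D' + length m)      ≡⟨ sym (+-suc D' (length m)) ⟩
    D' + suc (length m)      ≡⟨ sym length-shape ⟩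
    L n                      ∎
    where
      open ≤-Reasoning
      candidate : Palindrome (u n ++ x n ∷ m)
      candidate = subst₂ (λ v y → Palindrome (v ++ y ∷ m)) (sym shape) (sym xₙ≡a)
        (palindrome-extend (subst Palindrome shape (palindromic n 1≤n)) (palindrome-replicate D' a))
      length-shape : L n ≡ D' + suc (length m)
      length-shape = trans (cong length shape) (trans (length-++ (replicate D' a)) (cong (_+ suc (length m)) (length-replicate D')))

  extension : ∀ n → 1 ≤ n → D ≤ L n → Extension (L n) (L (suc n))
  extension n 1≤n D≤L with closure-extends (closure n 1≤n)
  ... | z , extended = record
    { gap      = length z
    ; total    = trans (cong length extended) (length-++ (u n))
    ; gap≤L    = closure-shortest (u n) (closure n 1≤n) extended (palindrome-double (x n) (palindromic n 1≤n))
    ; junction = λ end → junction-bound n 1≤n D≤L extended (trans (sym (letter-after n 1≤n)) end)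
    }

  open Invariant head break

  Stage : ℕ → Set
  Stage m = m + D ≤ L (suc (m + D)) × Good (L (suc (m + D)))

  stage : ∀ m → Stage m
  stage zero = subst (λ n → D ≤ n × Good n) (sym L-initial) (≤-refl , good-initial)
  stage (suc m) = ≤-<-trans grown (extension-grows ext) , good-step (mirror _ (s≤s z≤n)) (mirror _ (s≤s z≤n)) D≤L ext good
    where
      grown : m + D ≤ L (suc (m + D))
      grown = proj₁ (stage m)
      good : Good (L (suc (m + D)))
      good = proj₂ (stage m)
      D≤L : D ≤ L (suc (m + D))
      D≤L = ≤-trans (m≤n+m D m) grown
      ext : Extension (L (suc (m + D))) (L (suc (suc (m + D))))
      ext = extension (suc (m + D)) (s≤s z≤n) D≤L

  long-enough : ∀ m → m < L (suc (m + D))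
  long-enough m = <-≤-trans (m<m+n m (d≥1 1 (s≤s z≤n))) (proj₁ (stage m))

  -- The invariants for the whole word s: every window lies in a long enough prefix.
  sparse : ∀ i e → e < D → s i ≡ a ⊎ s (i + suc e) ≡ a
  sparse i e e<D = proj₁ (proj₂ (stage (i + suc e))) i e e<D (long-enough (i + suc e))

  runFree : ∀ q → ¬ Run q (suc (suc D))
  runFree q = proj₂ (proj₂ (stage (q + suc D))) q (long-enough (q + suc D))

  -- The palindromic prefix closed by the first letter of block k + 1 (again a) ends with a^(D+1).
  longRun : ∃ λ q → Run q (suc D)
  longRun with m≤n⇒∃[o]m+o≡n (first-block≤ d k (≤-trans (n≤1+n 1) k≥2))
  ... | m , D+m≡B = L n ∸ D , closing-run (mirror n (s≤s z≤n)) (≤-trans (m≤n+m D m) (proj₁ (stage m))) end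
    where
      n : ℕ
      n = suc (m + D)
      end : s (L n) ≡ a
      end = begin
        s (L n)                  ≡⟨ letter-after n (s≤s z≤n) ⟩
        x n                      ≡⟨ cong (x ∘ suc) (trans (+-comm m D) D+m≡B) ⟩
        x (suc (blockEnd d k))   ≡⟨ block-start k ⟩
        letter k k               ≡⟨ letter-period k ⟩
        a                        ∎
        where open ≡-Reasoning

  open Squares sparse runFree longRun public

theorem6p12 : (k : ℕ) .{{_ : NonZero k}} → 2 ≤ k →
    (d : ℕ → ℕ) → (∀ i → 1 ≤ i → 1 ≤ d i) →
    (x : ℕ → Fin k) → IsDirective k d x →
    (u : ℕ → List (Fin k)) → IsPalPrefixes x u →
    (s : ℕ → Fin k) → IsLimit u s →
    (r : ℕ) → 1 ≤ r → r ≤ d 1 →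
    ((2 * r ≤ d 1 + 1 →
        ∀ (w : List (Fin k)) → length w ≡ r →
          (Factor (w ++ w) s ⇔ (w ≡ replicate r (a₁ k))))
    × (d 1 + 1 < 2 * r →
        ∀ (w : List (Fin k)) → length w ≡ r → ¬ Factor (w ++ w) s))
theorem6p12 k k≥2 d d≥1 x directive u palPrefixes s limit r _ r≤D =
  (λ 2r≤1+D w |w|≡r → mk⇔ (square-is-power r r≤D w |w|≡r)
                           (λ { refl → short-square r (subst₂ _≤_ 2r≡r+r D+1≡1+D 2r≤1+D) })) ,
  (λ 1+D<2r → no-long-square r r≤D (subst₂ _<_ D+1≡1+D 2r≡r+r 1+D<2r))
  where
    open StandardEpisturmian k k≥2 d d≥1 x directive u palPrefixes s limit
    2r≡r+r : 2 * r ≡ r + r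
    2r≡r+r = cong (r +_) (+-identityʳ r)
    D+1≡1+D : d 1 + 1 ≡ suc (d 1)
    D+1≡1+D = +-comm (d 1) 1
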